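{- For all non-negative integers $n_0,n_1$, $$\tilde{\alpha}(0^{n_0},1^{n_1})\geq n_0+\frac{n_1}{2}-\frac{1}{2}.$$
   Context: All graphs are finite, simple and undirected. For a bipartite graph $G$ with (fixed) partite sets $A$ and $B$, a bihole of order $k$ is an independent set $I$ of $G$ with $|I\cap A|=|I\cap B|=k$. For non-negative integers $d_1<\dots<d_\ell$ and non-negative integers $n_1,\dots,n_\ell$, $\tilde{\alpha}(d_1^{n_1},\dots,d_\ell^{n_\ell})$ denotes the largest integer $k$ such that every bipartite graph $G$ with partite sets $A$ and $B$ satisfying $|A|=|B|=n_1+\dots+n_\ell$ and $|\{u\in A: d_G(u)=d_i\}|=n_i$ for every $i$ has a bihole of order $k$. Here $\tilde{\alpha}(0^{n_0},1^{n_1})$ is this quantity with degrees $0,1$ and multiplicities $n_0,n_1$. -}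

module Defs where

open import Data.Nat using (ℕ; _≟_)
open import Data.Fin using (Fin)
open import Data.Fin.Subset using (Subset; ∣_∣; _∈_; _∉_)
open import Data.Vec using (tabulate)
open import Data.Product using (Σ; _×_)
open import Relation.Nullary.Decidable using (⌊_⌋)
open import Relation.Binary.PropositionalEquality using (_≡_)

-- A (simple) bipartite graph with fixed partite sets A = Fin n and B = Fin n,
-- given by the neighbourhood (a subset of B) of each vertex of A.
BipGraph : ℕ → Set
BipGraph n = Fin n → Subset n

deg : ∀ {n} → BipGraph n → Fin n → ℕ
deg G u = ∣ G u ∣

degCount : ∀ {n} → BipGraph n → ℕ → ℕ
degCount {n} G d = ∣ tabulate (λ u → ⌊ deg G u ≟ d ⌋) ∣

Bihole : ∀ {n} → BipGraph n → ℕ → Set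
Bihole {n} G k =
  Σ (Subset n) λ S → Σ (Subset n) λ T →
    (∣ S ∣ ≡ k) × (∣ T ∣ ≡ k) ×
    (∀ a b → a ∈ S → b ∈ T → b ∉ G a)

-- k is admissible for degree sequence (0^{n0}, 1^{n1}): every bipartite graph
-- with |A| = |B| = n0 + n1 and exactly n0 (resp. n1) vertices of degree 0
-- (resp. 1) in A has a bihole of order k.
-- α̃(0^{n0},1^{n1}) is the largest admissible k.
Admissible01 : ℕ → ℕ → ℕ → Set
Admissible01 n0 n1 k =
  (G : BipGraph (n0 Data.Nat.+ n1)) →
  degCount G 0 ≡ n0 → degCount G 1 ≡ n1 → Bihole G k

-- Take for X ⊆ A the n0 isolated vertices together with ⌊n1/2⌋ vertices of degree one.
-- Their neighbourhood N(X) has at most ⌊n1/2⌋ vertices, so B ∖ N(X) still has at least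
-- n0 + ⌈n1/2⌉ ≥ |X| vertices, and X together with any |X| of them is a bihole.
module Submission where

open import Defs
open import Data.Nat using (ℕ; zero; suc; _+_; _*_; _≤_; z≤n; s≤s; _≟_; ⌊_/2⌋; ⌈_/2⌉)
open import Data.Nat.Properties
open import Data.Bool using (true; false)
open import Data.Fin using (Fin)
import Data.Fin as Fin
open import Data.Fin.Subset using (Subset; ∣_∣; _∈_; _∪_; ∁; ⊥; _⊆_)
open import Data.Fin.Subset.Properties
open import Data.Vec using (_∷_; []; here; there; tabulate)
open import Data.Product using (Σ; _×_; _,_)
open import Function using (_∘_)
open import Relation.Nullary.Decidable using (⌊_⌋)
open import Relation.Binary.PropositionalEquality using (_≡_; refl; sym; trans; cong; subst)

∣p∪q∣≤∣p∣+∣q∣ : ∀ {n} (p q : Subset n) → ∣ p ∪ q ∣ ≤ ∣ p ∣ + ∣ q ∣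
∣p∪q∣≤∣p∣+∣q∣ []          []          = z≤n
∣p∪q∣≤∣p∣+∣q∣ (true ∷ p)  (true ∷ q)  =
  s≤s (≤-trans (m≤n⇒m≤1+n (∣p∪q∣≤∣p∣+∣q∣ p q)) (≤-reflexive (sym (+-suc ∣ p ∣ ∣ q ∣))))
∣p∪q∣≤∣p∣+∣q∣ (true ∷ p)  (false ∷ q) = s≤s (∣p∪q∣≤∣p∣+∣q∣ p q)
∣p∪q∣≤∣p∣+∣q∣ (false ∷ p) (true ∷ q)  =
  ≤-trans (s≤s (∣p∪q∣≤∣p∣+∣q∣ p q)) (≤-reflexive (sym (+-suc ∣ p ∣ ∣ q ∣)))
∣p∪q∣≤∣p∣+∣q∣ (false ∷ p) (false ∷ q) = ∣p∪q∣≤∣p∣+∣q∣ p q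

∣p∪q∣≤m+n : ∀ {n k l} (p q : Subset n) → ∣ p ∣ ≤ k → ∣ q ∣ ≤ l → ∣ p ∪ q ∣ ≤ k + l
∣p∪q∣≤m+n p q ∣p∣≤k ∣q∣≤l = ≤-trans (∣p∪q∣≤∣p∣+∣q∣ p q) (+-mono-≤ ∣p∣≤k ∣q∣≤l)

⊆-with-size : ∀ {n} (s : Subset n) k → k ≤ ∣ s ∣ → Σ (Subset n) λ t → ∣ t ∣ ≡ k × t ⊆ s
⊆-with-size {n} s        zero    _               = ⊥ , ∣⊥∣≡0 n , ⊥⊆
⊆-with-size (true ∷ s)  (suc k) (s≤s k≤∣s∣) with ⊆-with-size s k k≤∣s∣
... | t , ∣t∣≡k , t⊆s = true ∷ t , cong suc ∣t∣≡k , s⊆s t⊆s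
⊆-with-size (false ∷ s) (suc k) k≤∣s∣       with ⊆-with-size s (suc k) k≤∣s∣
... | t , ∣t∣≡k , t⊆s = false ∷ t , ∣t∣≡k , out⊆ t⊆s

-- Graphs with |A| ≠ |B| are needed for the induction on A; on square graphs
-- degreeCount is definitionally degCount.
degreeCount : ∀ {m n} → (Fin m → Subset n) → ℕ → ℕ
degreeCount G d = ∣ tabulate (λ u → ⌊ ∣ G u ∣ ≟ d ⌋) ∣

neighbourhood : ∀ {m n} → (Fin m → Subset n) → Subset m → Subset n
neighbourhood {zero}  G []          = ⊥
neighbourhood {suc m} G (true ∷ X)  = G Fin.zero ∪ neighbourhood (G ∘ Fin.suc) X
neighbourhood {suc m} G (false ∷ X) = neighbourhood (G ∘ Fin.suc) X

∈-neighbourhood : ∀ {m n} (G : Fin m → Subset n) X {a b} →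
  a ∈ X → b ∈ G a → b ∈ neighbourhood G X
∈-neighbourhood G (true ∷ X)  here        b∈Ga = p⊆p∪q (neighbourhood (G ∘ Fin.suc) X) b∈Ga
∈-neighbourhood G (true ∷ X)  (there a∈X) b∈Ga =
  q⊆p∪q (G Fin.zero) _ (∈-neighbourhood (G ∘ Fin.suc) X a∈X b∈Ga)
∈-neighbourhood G (false ∷ X) (there a∈X) b∈Ga = ∈-neighbourhood (G ∘ Fin.suc) X a∈X b∈Ga

set-with-small-neighbourhood : ∀ {m n} (G : Fin m → Subset n) j → j ≤ degreeCount G 1 →
  Σ (Subset m) λ X → ∣ X ∣ ≡ degreeCount G 0 + j × ∣ neighbourhood G X ∣ ≤ j
set-with-small-neighbourhood {zero} {n} G zero _ = [] , refl , ≤-reflexive (∣⊥∣≡0 n)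
set-with-small-neighbourhood {suc m} G j j≤ with ∣ G Fin.zero ∣ in ∣G₀∣≡
... | zero with set-with-small-neighbourhood (G ∘ Fin.suc) j j≤
...   | X , ∣X∣≡ , ∣NX∣≤ =
  true ∷ X , cong suc ∣X∣≡ , ∣p∪q∣≤m+n (G Fin.zero) _ (≤-reflexive ∣G₀∣≡) ∣NX∣≤
set-with-small-neighbourhood {suc m} G zero j≤ | suc zero
  with set-with-small-neighbourhood (G ∘ Fin.suc) zero z≤n
...   | X , ∣X∣≡ , ∣NX∣≤ = false ∷ X , ∣X∣≡ , ∣NX∣≤
set-with-small-neighbourhood {suc m} G (suc j) (s≤s j≤) | suc zero
  with set-with-small-neighbourhood (G ∘ Fin.suc) j j≤
...   | X , ∣X∣≡ , ∣NX∣≤ =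
  true ∷ X , trans (cong suc ∣X∣≡) (sym (+-suc _ j)) ,
  ∣p∪q∣≤m+n (G Fin.zero) _ (≤-reflexive ∣G₀∣≡) ∣NX∣≤
set-with-small-neighbourhood {suc m} G j j≤ | suc (suc _)
  with set-with-small-neighbourhood (G ∘ Fin.suc) j j≤
...   | X , ∣X∣≡ , ∣NX∣≤ = false ∷ X , ∣X∣≡ , ∣NX∣≤

bihole-of-small-neighbourhood : ∀ {n k} (G : BipGraph n) (X : Subset n) →
  ∣ X ∣ ≡ k → k + ∣ neighbourhood G X ∣ ≤ n → Bihole G k
bihole-of-small-neighbourhood {n} {k} G X ∣X∣≡k room
  with ⊆-with-size (∁ (neighbourhood G X)) k k≤∣∁NX∣
  where
  k≤∣∁NX∣ : k ≤ ∣ ∁ (neighbourhood G X) ∣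
  k≤∣∁NX∣ = subst (k ≤_) (sym (∣∁p∣≡n∸∣p∣ (neighbourhood G X))) (m+n≤o⇒m≤o∸n k room)
... | T , ∣T∣≡k , T⊆∁NX =
  X , T , ∣X∣≡k , ∣T∣≡k ,
  λ a b a∈X b∈T b∈Ga → x∈p⇒x∉∁p (∈-neighbourhood G X a∈X b∈Ga) (T⊆∁NX b∈T)

⌊n/2⌋+⌊n/2⌋≤n : ∀ n → ⌊ n /2⌋ + ⌊ n /2⌋ ≤ n
⌊n/2⌋+⌊n/2⌋≤n n = ≤-trans (+-monoʳ-≤ ⌊ n /2⌋ (⌊n/2⌋≤⌈n/2⌉ n)) (≤-reflexive (⌊n/2⌋+⌈n/2⌉≡n n))

⌈n/2⌉≤1+⌊n/2⌋ : ∀ n → ⌈ n /2⌉ ≤ suc ⌊ n /2⌋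
⌈n/2⌉≤1+⌊n/2⌋ zero          = z≤n
⌈n/2⌉≤1+⌊n/2⌋ (suc zero)    = s≤s z≤n
⌈n/2⌉≤1+⌊n/2⌋ (suc (suc n)) = s≤s (⌈n/2⌉≤1+⌊n/2⌋ n)

n≤2*⌊n/2⌋+1 : ∀ n → n ≤ 2 * ⌊ n /2⌋ + 1
n≤2*⌊n/2⌋+1 n = begin
  n                         ≡⟨ sym (⌊n/2⌋+⌈n/2⌉≡n n) ⟩
  ⌊ n /2⌋ + ⌈ n /2⌉         ≤⟨ +-monoʳ-≤ ⌊ n /2⌋ (⌈n/2⌉≤1+⌊n/2⌋ n) ⟩
  ⌊ n /2⌋ + suc ⌊ n /2⌋     ≡⟨ +-suc ⌊ n /2⌋ ⌊ n /2⌋ ⟩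
  suc (⌊ n /2⌋ + ⌊ n /2⌋)   ≡⟨ cong (λ x → suc (⌊ n /2⌋ + x)) (sym (+-identityʳ ⌊ n /2⌋)) ⟩
  suc (2 * ⌊ n /2⌋)         ≡⟨ +-comm 1 (2 * ⌊ n /2⌋) ⟩
  2 * ⌊ n /2⌋ + 1           ∎
  where open ≤-Reasoning

lemma5 : (n0 n1 : ℕ) →
    Σ ℕ λ k → Admissible01 n0 n1 k × (2 * n0 + n1 ≤ 2 * k + 1)
lemma5 n0 n1 = n0 + h , admissible , bound
  where
  open ≤-Reasoning
  h = ⌊ n1 /2⌋

  admissible : Admissible01 n0 n1 (n0 + h)
  admissible G deg0 deg1
    with set-with-small-neighbourhood G h (subst (h ≤_) (sym deg1) (⌊n/2⌋≤n n1))
  ... | X , ∣X∣≡ , ∣NX∣≤h =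
    bihole-of-small-neighbourhood G X (trans ∣X∣≡ (cong (_+ h) deg0)) (begin
    n0 + h + ∣ neighbourhood G X ∣ ≤⟨ +-monoʳ-≤ (n0 + h) ∣NX∣≤h ⟩
    n0 + h + h                     ≡⟨ +-assoc n0 h h ⟩
    n0 + (h + h)                   ≤⟨ +-monoʳ-≤ n0 (⌊n/2⌋+⌊n/2⌋≤n n1) ⟩
    n0 + n1                        ∎)

  bound : 2 * n0 + n1 ≤ 2 * (n0 + h) + 1
  bound = begin
    2 * n0 + n1             ≤⟨ +-monoʳ-≤ (2 * n0) (n≤2*⌊n/2⌋+1 n1) ⟩
    2 * n0 + (2 * h + 1)    ≡⟨ sym (+-assoc (2 * n0) (2 * h) 1) ⟩
    2 * n0 + 2 * h + 1      ≡⟨ cong (_+ 1) (sym (*-distribˡ-+ 2 n0 h)) ⟩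
    2 * (n0 + h) + 1        ∎
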